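{- Let $w\in S_\infty$, $n\ge1$, and let $\varphi$ be a flag that is not the identity. Let $i$ be the smallest positive integer with $\varphi(i)>i$, and let $j=\varphi(i)-1$. If $i>n$ or $j\ge n$, then $\mathrm{RFC}_n(w,\varphi)=\mathrm{RFC}_n(w,\varphi-\mathbf e_i)$. Otherwise, $\mathrm{RFC}_n(w,\varphi)=\mathfrak D^{\mathrm{RF}_n(w)}_j\,\mathrm{RFC}_n(w,\varphi-\mathbf e_i)$.
   Context: $s_i\in S_\infty$ swaps $i,i+1$; reduced words for $w$ are minimal-length words $i_1\cdots i_m$ with $w=s_{i_1}\cdots s_{i_m}$. $\mathrm{RF}_n(w)$ is the set of factorizations $r^{(\bullet)}=(r^{(n)}|\cdots|r^{(1)})$ of reduced words $r=r^{(n)}\cdots r^{(1)}$ for $w$ into exactly $n$ consecutive, possibly empty, strictly increasing subwords. A flag is a weakly increasing $\varphi:\mathbb{Z}_{>0}\to\mathbb{Z}_{>0}$ with $\varphi(m)\ge m$; $(\varphi-\mathbf e_i)(l)=\varphi(l)-\delta_{il}$. $r^{(\bullet)}$ is $\varphi$-flagged if $\varphi(r^{(k)}_1)\ge k$ for each nonempty $r^{(k)}$ (first letter $r^{(k)}_1$). $\mathrm{RFC}_n(w,\varphi)\subseteq\mathrm{RF}_n(w)$ is the set of $\varphi$-flagged elements. Morse–Schilling raising operators on $\mathrm{RF}_n(w)$, $1\le i<n$: take elements $b$ of $r^{(i)}$ in decreasing order, pairing each with the smallest not-yet-paired $a\in r^{(i+1)}$ with $a>b$ (else $b$ unpaired);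 $L_i$ = unpaired letters of $r^{(i+1)}$. If $L_i=\varnothing$, $e_i(r^{(\bullet)})=0$; otherwise with $a=\max L_i$, $s=\min\{t\ge0:a+t+1\notin r^{(i+1)}\}$, $e_i$ removes $a$ from $r^{(i+1)}$ and adds $a+s$ to $r^{(i)}$. Demazure operator: for $X\subseteq\mathrm{RF}_n(w)$, $\mathfrak D^{\mathrm{RF}_n(w)}_jX=\{b\in\mathrm{RF}_n(w):e_j^k(b)\in X\text{ for some }k\ge0\}$. -}

module Defs where

open import Data.Nat using (ℕ; zero; suc; _+_; _∸_; _≤_; _<_; _≟_; _<?_; _⊔_)
open import Data.Bool using (Bool; true; false; if_then_else_)
open import Data.List using (List; []; _∷_; _++_; length; foldr)
open import Data.List.Relation.Unary.All using (All)
open import Data.List.Relation.Unary.Linked using (Linked)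
open import Data.List.Membership.DecPropositional _≟_ using (_∈?_)
open import Data.Vec using (Vec; []; _∷_; lookup)
open import Data.Vec.Relation.Unary.All as VAll using ()
open import Data.Fin using (Fin; toℕ)
open import Data.Maybe using (Maybe; just; nothing; _>>=_)
open import Data.Product using (_×_; Σ; ∃; ∃-syntax; _,_)
open import Relation.Nullary using (¬_; does)
open import Relation.Binary.PropositionalEquality using (_≡_)

swap : ℕ → ℕ → ℕ
swap i x = if does (x ≟ i) then suc i else (if does (x ≟ suc i) then i else x)

perm : List ℕ → ℕ → ℕ
perm []      x = x
perm (i ∷ r) x = swap i (perm r x)

ValidWord : List ℕ → Set
ValidWord r = All (λ a → 1 ≤ a) r

Represents : List ℕ → (ℕ → ℕ) → Set
Represents r w = ∀ x → 1 ≤ x → perm r x ≡ w x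

InSInf : (ℕ → ℕ) → Set
InSInf w = ∃[ u ] (ValidWord u × Represents u w)

IsReducedWord : (ℕ → ℕ) → List ℕ → Set
IsReducedWord w r =
  ValidWord r × Represents r w ×
  (∀ u → ValidWord u → Represents u w → length r ≤ length u)

-- Factorizations.  A factorization (r^(n)|⋯|r^(1)) is a vector f of
-- length n with  lookup f k = r^(k+1)  (0-based position k).

Factorization : ℕ → Set
Factorization n = Vec (List ℕ) n

word : ∀ {n} → Factorization n → List ℕ
word []       = []
word (x ∷ xs) = word xs ++ x

Increasing : List ℕ → Set
Increasing = Linked _<_

RF : (n : ℕ) → (ℕ → ℕ) → Factorization n → Set
RF n w f = VAll.All Increasing f × IsReducedWord w (word f)

IsFlag : (ℕ → ℕ) → Set
IsFlag φ = (∀ m → 1 ≤ m → m ≤ φ m) × (∀ a b → 1 ≤ a → a ≤ b → φ a ≤ φ b)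

IsIdentityFlag : (ℕ → ℕ) → Set
IsIdentityFlag φ = ∀ m → 1 ≤ m → φ m ≡ m

_-e_ : (ℕ → ℕ) → ℕ → (ℕ → ℕ)
(φ -e i) l = if does (l ≟ i) then φ l ∸ 1 else φ l

Flagged : ∀ {n} → (ℕ → ℕ) → Factorization n → Set
Flagged {n} φ f = ∀ (k : Fin n) (a : ℕ) (rest : List ℕ) →
  lookup f k ≡ a ∷ rest → suc (toℕ k) ≤ φ a

RFC : (n : ℕ) → (ℕ → ℕ) → (ℕ → ℕ) → Factorization n → Set
RFC n w φ f = RF n w f × Flagged φ f

removeFirstAbove : ℕ → List ℕ → List ℕ
removeFirstAbove b []      = []
removeFirstAbove b (a ∷ as) = if does (b <? a) then as else a ∷ removeFirstAbove b as

-- L_i: unpaired letters of A = r^(i+1) after pairing with B = r^(i),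
-- the letters of B (increasing) being processed in decreasing order.
unpaired : List ℕ → List ℕ → List ℕ
unpaired A B = foldr removeFirstAbove A B

-- s = min{t ≥ 0 : a+t+1 ∉ A}, computed with fuel (length A suffices)
shiftLen : ℕ → ℕ → List ℕ → ℕ
shiftLen zero     a A = 0
shiftLen (suc fu) a A = if does (suc a ∈? A) then suc (shiftLen fu (suc a) A) else 0

removeElt : ℕ → List ℕ → List ℕ
removeElt a []       = []
removeElt a (x ∷ xs) = if does (x ≟ a) then xs else x ∷ removeElt a xs

insertSorted : ℕ → List ℕ → List ℕ
insertSorted a []       = a ∷ []
insertSorted a (x ∷ xs) = if does (x <? a) then x ∷ insertSorted a xs else a ∷ x ∷ xs

-- one step on the pair (B = r^(i), A = r^(i+1)); nothing means 0
raisePair : List ℕ → List ℕ → Maybe (List ℕ × List ℕ)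
raisePair B A with unpaired A B
... | []    = nothing
... | L@(_ ∷ _) =
  let a = foldr _⊔_ 0 L
      s = shiftLen (length A) a A
  in just (insertSorted (a + s) B , removeElt a A)

-- acts on positions k, k+1 (0-based), i.e. on r^(k+1), r^(k+2)
raiseAt : ∀ {n} → ℕ → Factorization n → Maybe (Factorization n)
raiseAt zero (B ∷ A ∷ rest) with raisePair B A
... | nothing        = nothing
... | just (B' , A') = just (B' ∷ A' ∷ rest)
raiseAt zero _ = nothing
raiseAt (suc k) [] = nothing
raiseAt (suc k) (x ∷ rest) with raiseAt k rest
... | nothing = nothing
... | just r  = just (x ∷ r)

-- e_i (1 ≤ i < n); returns nothing (= 0) otherwise
e : ∀ {n} → ℕ → Factorization n → Maybe (Factorization n)
e zero    f = nothing
e (suc k) f = raiseAt k f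

eIter : ∀ {n} → ℕ → ℕ → Factorization n → Maybe (Factorization n)
eIter i zero    f = just f
eIter i (suc k) f = e i f >>= eIter i k

Demazure : (n : ℕ) → (ℕ → ℕ) → ℕ → (Factorization n → Set) → Factorization n → Set
Demazure n w j X b = RF n w b × (∃[ k ] ∃[ x ] (eIter j k b ≡ just x × X x))

{-# OPTIONS --safe #-}
-- Write ψ = φ - e_i and j = φ(i) - 1.  The flags φ and ψ differ only at i, so a φ-flagged
-- factorization fails to be ψ-flagged only if r^(j+1) begins with i, which is impossible when
-- j ≥ n.  Otherwise, as φ(m) = m < i for m < i, φ-flaggedness at level j forces all letters of
-- r^(j) to be ≥ i; so the letter i of r^(j+1) is unpaired and e_j moves a = max L_j ≥ i into
-- r^(j) as a + s.  This keeps φ-flaggedness and shortens r^(j+1), so iterating e_j reaches a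
-- ψ-flagged factorization.  Conversely, an e_j-step only changes the first letters of r^(j)
-- and r^(j+1); if its result is φ-flagged, the new r^(j) consists of letters ≥ i and contains
-- a, and this makes the old factorization φ-flagged.
-- Throughout, e_j preserves RF_n(w): by the braid relations
-- (s_{a+1} ⋯ s_{a+s})(s_a ⋯ s_{a+s}) = (s_a ⋯ s_{a+s})(s_a ⋯ s_{a+s-1}), so the new word represents
-- w with the same length, and a repeated letter v in the new r^(j) would put s_v s_v = 1 into a
-- reduced word.
module Submission where

open import Defs
open import Data.Nat using (ℕ; zero; suc; _+_; _∸_; _≤_; _<_; _≟_; _<?_; _⊔_; s≤s)
open import Data.Nat.Properties
open import Data.Sum using (_⊎_; inj₁; inj₂; [_,_]′)
open import Data.Product using (_×_; _,_; proj₁; proj₂; map₂; ∃-syntax)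
open import Data.List using (List; []; _∷_; _++_; length; foldr)
open import Data.List.Properties using (length-++; ++-assoc; ++-identityʳ)
open import Data.List.Relation.Unary.All as All using (All; []; _∷_)
open import Data.List.Relation.Unary.All.Properties using (++⁺; ++⁻ˡ; ++⁻ʳ; anti-mono)
open import Data.List.Relation.Unary.Any as Any using (here; there)
open import Data.List.Relation.Unary.AllPairs using (AllPairs; []; _∷_)
open import Data.List.Relation.Unary.Linked.Properties using (AllPairs⇒Linked; Linked⇒AllPairs)
open import Data.List.Membership.Propositional using (_∈_; _∉_)
open import Data.List.Membership.Propositional.Properties using (∈-++⁺ˡ; ∈-++⁺ʳ)
open import Data.List.Relation.Binary.Subset.Propositional using (_⊆_)
open import Data.List.Membership.DecPropositional _≟_ using (_∈?_)
open import Data.Vec using ([]; _∷_; lookup)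
open import Data.Vec.Relation.Unary.All as VAll using ()
open import Data.Fin using (toℕ) renaming (zero to fzero; suc to fsuc)
open import Data.Fin.Properties using (toℕ<n)
open import Data.Maybe using (just; nothing)
open import Data.Unit using (⊤; tt)
open import Data.Empty using (⊥-elim)
open import Function using (_∘_; id)
open import Function.Bundles using (_⇔_; mk⇔; Equivalence)
open import Relation.Nullary using (¬_; yes; no; contradiction)
open import Relation.Nullary.Decidable using (dec-true; dec-false)
open import Relation.Binary.PropositionalEquality

-- Words and permutations

data SwapView (i : ℕ) : ℕ → Set where
  at-i     : SwapView i i
  at-suc-i : SwapView i (suc i)
  off      : ∀ {x} → x ≢ i → x ≢ suc i → SwapView i x

swapView : ∀ i x → SwapView i x
swapView i x with x ≟ i | x ≟ suc i
... | yes refl | _        = at-i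
... | no _     | yes refl = at-suc-i
... | no p     | no q     = off p q

swap-i : ∀ i → swap i i ≡ suc i
swap-i i rewrite dec-true (i ≟ i) refl = refl

swap-suc-i : ∀ i → swap i (suc i) ≡ i
swap-suc-i i rewrite dec-false (suc i ≟ i) 1+n≢n | dec-true (suc i ≟ suc i) refl = refl

swap-off : ∀ {i x} → x ≢ i → x ≢ suc i → swap i x ≡ x
swap-off {i} {x} p q rewrite dec-false (x ≟ i) p | dec-false (x ≟ suc i) q = refl

swap-fix : ∀ {i x} → x < i ⊎ suc i < x → swap i x ≡ x
swap-fix (inj₁ x<i)   = swap-off (<⇒≢ x<i) (<⇒≢ (m<n⇒m<1+n x<i))
swap-fix (inj₂ 1+i<x) = swap-off (>⇒≢ (<-trans (n<1+n _) 1+i<x)) (>⇒≢ 1+i<x)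

swap-involutive : ∀ i x → swap i (swap i x) ≡ x
swap-involutive i x with swapView i x
... | at-i     rewrite swap-i i | swap-suc-i i = refl
... | at-suc-i rewrite swap-suc-i i | swap-i i = refl
... | off p q  rewrite swap-off p q | swap-off p q = refl

Distant : ℕ → ℕ → Set
Distant c d = suc c < d ⊎ suc d < c

Distant-sym : ∀ {c d} → Distant c d → Distant d c
Distant-sym (inj₁ p) = inj₂ p
Distant-sym (inj₂ p) = inj₁ p

swap-fix-distant : ∀ {c d} → Distant c d → swap c d ≡ d
swap-fix-distant (inj₁ p) = swap-fix (inj₂ p)
swap-fix-distant (inj₂ p) = swap-fix (inj₁ (<-trans (n<1+n _) p))

swap-fix-suc-distant : ∀ {c d} → Distant c d → swap c (suc d) ≡ suc d
swap-fix-suc-distant (inj₁ p) = swap-fix (inj₂ (m<n⇒m<1+n p))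
swap-fix-suc-distant (inj₂ p) = swap-fix (inj₁ p)

swap-comm : ∀ {c d} z → Distant c d → swap c (swap d z) ≡ swap d (swap c z)
swap-comm {c} {d} z cd with swapView d z
... | at-i rewrite swap-i d | swap-fix-suc-distant cd | swap-fix-distant cd | swap-i d = refl
... | at-suc-i rewrite swap-suc-i d | swap-fix-distant cd | swap-fix-suc-distant cd | swap-suc-i d = refl
... | off p q with swapView c z
...   | at-i rewrite swap-off p q | swap-i c | swap-fix-suc-distant (Distant-sym cd) = refl
...   | at-suc-i rewrite swap-off p q | swap-suc-i c | swap-fix-distant (Distant-sym cd) = refl
...   | off p′ q′ rewrite swap-off p q | swap-off p′ q′ | swap-off p q = refl

swap-braid : ∀ a z → swap a (swap (suc a) (swap a z)) ≡ swap (suc a) (swap a (swap (suc a) z))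
swap-braid a z with swapView a z
... | at-i rewrite swap-i a | swap-i (suc a) | swap-fix {a} (inj₂ ≤-refl)
                 | swap-fix {suc a} (inj₁ (n<1+n a)) | swap-i a | swap-i (suc a) = refl
... | at-suc-i rewrite swap-suc-i a | swap-fix {suc a} (inj₁ (n<1+n a)) | swap-i a
                     | swap-i (suc a) | swap-fix {a} (inj₂ ≤-refl) | swap-suc-i (suc a) = refl
... | off p q with swapView (suc a) z
...   | at-i = contradiction refl q
...   | at-suc-i rewrite swap-fix {a} (inj₂ ≤-refl) | swap-suc-i (suc a) | swap-suc-i a
                       | swap-fix {suc a} (inj₁ (n<1+n a)) = refl
...   | off p′ q′ rewrite swap-off p q | swap-off p′ q′ | swap-off p q | swap-off p′ q′ = refl

perm-++ : ∀ u v x → perm (u ++ v) x ≡ perm u (perm v x)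
perm-++ []      v x = refl
perm-++ (i ∷ u) v x = cong (swap i) (perm-++ u v x)

perm-++₃ : ∀ u v w x → perm (u ++ v ++ w) x ≡ perm u (perm v (perm w x))
perm-++₃ u v w x = trans (perm-++ u (v ++ w) x) (cong (perm u) (perm-++ v w x))

swap-perm-comm : ∀ {c} v z → All (Distant c) v → swap c (perm v z) ≡ perm v (swap c z)
swap-perm-comm []      z []         = refl
swap-perm-comm (d ∷ v) z (cd ∷ cv) =
  trans (swap-comm (perm v z) cd) (cong (swap d) (swap-perm-comm v z cv))

AllDistant : List ℕ → List ℕ → Set
AllDistant u v = All (λ c → All (Distant c) v) u

perm-comm : ∀ u v z → AllDistant u v → perm u (perm v z) ≡ perm v (perm u z)
perm-comm []      v z []         = refl
perm-comm (c ∷ u) v z (cv ∷ uv) =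
  trans (cong (swap c) (perm-comm u v z uv)) (swap-perm-comm v (perm u z) cv)

run : ℕ → ℕ → List ℕ
run a zero    = []
run a (suc t) = a ∷ run (suc a) t

length-run : ∀ a t → length (run a t) ≡ t
length-run a zero    = refl
length-run a (suc t) = cong suc (length-run (suc a) t)

run-≥ : ∀ a t → All (a ≤_) (run a t)
run-≥ a zero    = []
run-≥ a (suc t) = ≤-refl ∷ All.map <⇒≤ (run-≥ (suc a) t)

run-< : ∀ a t → All (_< a + t) (run a t)
run-< a zero    = []
run-< a (suc t) rewrite +-suc a t = s≤s (m≤m+n a t) ∷ run-< (suc a) t

run-∷ʳ : ∀ a t → run a (suc t) ≡ run a t ++ (a + t) ∷ []
run-∷ʳ a zero    = cong (_∷ []) (sym (+-identityʳ a))
run-∷ʳ a (suc t) rewrite +-suc a t = cong (a ∷_) (run-∷ʳ (suc a) t)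

Distant-run : ∀ {c} b t → suc c < b → All (Distant c) (run b t)
Distant-run b zero    _ = []
Distant-run b (suc t) p = inj₁ p ∷ Distant-run (suc b) t (m<n⇒m<1+n p)

run-distant-above : ∀ b t {Q} → All (b + t <_) Q → AllDistant (run b t) Q
run-distant-above b t Q> = All.map (λ c<b+t → All.map (λ b+t<q → inj₁ (<-≤-trans (s≤s c<b+t) b+t<q)) Q>)
                                   (run-< b t)

run-distant-below : ∀ b t {Bl} → All (λ d → suc d < b) Bl → AllDistant (run b t) Bl
run-distant-below b t Bl< = All.map (λ b≤c → All.map (λ d+1<b → inj₂ (<-≤-trans d+1<b b≤c)) Bl<)
                                    (run-≥ b t)

perm-run-shift : ∀ t a z →
  perm (run a (suc t)) (perm (run a t) z) ≡ perm (run (suc a) t) (perm (run a (suc t)) z)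
perm-run-shift zero    a z = refl
perm-run-shift (suc t) a z = begin
  swap a (swap (suc a) (R₂ (swap a (R₁ z))))
    ≡⟨ cong (swap a ∘ swap (suc a)) (sym (swap-perm-comm (run (suc (suc a)) t) (R₁ z) far)) ⟩
  swap a (swap (suc a) (swap a (R₂ (R₁ z))))
    ≡⟨ swap-braid a (R₂ (R₁ z)) ⟩
  swap (suc a) (swap a (swap (suc a) (R₂ (R₁ z))))
    ≡⟨ cong (swap (suc a) ∘ swap a) (perm-run-shift t (suc a) z) ⟩
  swap (suc a) (swap a (R₂ (perm (run (suc a) (suc t)) z)))
    ≡⟨ cong (swap (suc a)) (swap-perm-comm (run (suc (suc a)) t) _ far) ⟩
  swap (suc a) (R₂ (swap a (perm (run (suc a) (suc t)) z))) ∎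
  where
  open ≡-Reasoning
  R₁ R₂ : ℕ → ℕ
  R₁ = perm (run (suc a) t)
  R₂ = perm (run (suc (suc a)) t)
  far : All (Distant a) (run (suc (suc a)) t)
  far = Distant-run (suc (suc a)) t (n<1+n (suc a))

Sorted : List ℕ → Set
Sorted = AllPairs _<_

increasing⇒sorted : ∀ {L} → Increasing L → Sorted L
increasing⇒sorted = Linked⇒AllPairs <-trans

sorted-head-≤ : ∀ {x xs} → Sorted (x ∷ xs) → All (x ≤_) (x ∷ xs)
sorted-head-≤ (x<xs ∷ _) = ≤-refl ∷ All.map <⇒≤ x<xs

∈-sorted-≤-head : ∀ {a x xs} → Sorted (x ∷ xs) → a ∈ x ∷ xs → a ≤ x → a ≡ x
∈-sorted-≤-head _          (here a≡x)   _   = a≡x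
∈-sorted-≤-head (x<xs ∷ _) (there a∈xs) a≤x = contradiction (All.lookup x<xs a∈xs) (≤⇒≯ a≤x)

run-∈-tail : ∀ {a t x xs} → x < a → All (_∈ x ∷ xs) (run a t) → All (_∈ xs) (run a t)
run-∈-tail {a} {t} x<a run∈ = All.zipWith (λ (a≤z , z∈) → Any.tail (>⇒≢ (<-≤-trans x<a a≤z)) z∈)
                                            (run-≥ a t , run∈)

sorted-split-≥ : ∀ a t {L} → Sorted L → All (a ≤_) L → All (_∈ L) (run a t) →
  ∃[ Q ] (L ≡ run a t ++ Q × All (a + t ≤_) Q)
sorted-split-≥ a zero {L} _ a≤L _ rewrite +-identityʳ a = L , refl , a≤L
sorted-split-≥ a (suc t) {x ∷ xs} s@(x<xs ∷ s′) (a≤x ∷ _) (a∈ ∷ run∈)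
  with refl ← ∈-sorted-≤-head s a∈ a≤x
  with Q , refl , Q≥ ← sorted-split-≥ (suc a) t s′ x<xs (run-∈-tail (n<1+n a) run∈)
  rewrite +-suc a t = Q , refl , Q≥

sorted-split : ∀ a t {L} → Sorted L → All (_∈ L) (run a t) →
  ∃[ P ] ∃[ Q ] (L ≡ P ++ run a t ++ Q × All (_< a) P × All (a + t ≤_) Q)
sorted-split a t {[]} _ run∈ with Q , eq , Q≥ ← sorted-split-≥ a t [] [] run∈ = [] , Q , eq , [] , Q≥
sorted-split a t {x ∷ xs} s@(_ ∷ s′) run∈ with x <? a
... | yes x<a with P , Q , eq , P< , Q≥ ← sorted-split a t s′ (run-∈-tail x<a run∈)
  = x ∷ P , Q , cong (x ∷_) eq , x<a ∷ P< , Q≥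
... | no x≮a with Q , eq , Q≥ ← sorted-split-≥ a t s (All.map (≤-trans (≮⇒≥ x≮a)) (sorted-head-≤ s)) run∈
  = [] , Q , eq , [] , Q≥

-- The pairing of r^(i) with r^(i+1)

removeFirstAbove-> : ∀ {b x} xs → b < x → removeFirstAbove b (x ∷ xs) ≡ xs
removeFirstAbove-> {b} {x} xs b<x rewrite dec-true (b <? x) b<x = refl

removeFirstAbove-≤ : ∀ {b x} xs → x ≤ b → removeFirstAbove b (x ∷ xs) ≡ x ∷ removeFirstAbove b xs
removeFirstAbove-≤ {b} {x} xs x≤b rewrite dec-false (b <? x) (≤⇒≯ x≤b) = refl

removeFirstAbove-⊆ : ∀ b V → removeFirstAbove b V ⊆ V
removeFirstAbove-⊆ b []       z∈ = z∈
removeFirstAbove-⊆ b (x ∷ xs) z∈ with b <? x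
... | yes b<x rewrite removeFirstAbove-> xs b<x = there z∈
... | no b≮x rewrite removeFirstAbove-≤ xs (≮⇒≥ b≮x) with z∈
...   | here z≡x  = here z≡x
...   | there z∈′ = there (removeFirstAbove-⊆ b xs z∈′)

removeFirstAbove-sorted : ∀ b {V} → Sorted V → Sorted (removeFirstAbove b V)
removeFirstAbove-sorted b {[]}     []           = []
removeFirstAbove-sorted b {x ∷ xs} (x<xs ∷ s) with b <? x
... | yes b<x rewrite removeFirstAbove-> xs b<x = s
... | no b≮x rewrite removeFirstAbove-≤ xs (≮⇒≥ b≮x) =
  anti-mono (removeFirstAbove-⊆ b xs) x<xs ∷ removeFirstAbove-sorted b s

LeastAbove : ℕ → List ℕ → ℕ → Set
LeastAbove b V z = b < z × (∀ {y} → y ∈ V → b < y → z ≤ y)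

removeFirstAbove-removed : ∀ b {V z} → Sorted V → z ∈ V → z ∉ removeFirstAbove b V → LeastAbove b V z
removeFirstAbove-removed b {x ∷ xs} (x<xs ∷ s) z∈ z∉ with b <? x
... | yes b<x rewrite removeFirstAbove-> xs b<x with z∈
...   | here refl  = b<x , λ { (here refl) _ → ≤-refl ; (there y∈) _ → <⇒≤ (All.lookup x<xs y∈) }
...   | there z∈xs = contradiction z∈xs z∉
removeFirstAbove-removed b {x ∷ xs} (x<xs ∷ s) z∈ z∉ | no b≮x
  rewrite removeFirstAbove-≤ xs (≮⇒≥ b≮x) with z∈
... | here refl  = contradiction (here refl) z∉
... | there z∈xs with b<z , least ← removeFirstAbove-removed b s z∈xs (z∉ ∘ there) =
  b<z , λ { (here refl) b<y → contradiction b<y b≮x ; (there y∈) b<y → least y∈ b<y }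

removeFirstAbove-removes : ∀ b {V z} → Sorted V → z ∈ V → LeastAbove b V z → z ∉ removeFirstAbove b V
removeFirstAbove-removes b {x ∷ xs} (x<xs ∷ s) z∈ (b<z , least) with b <? x
... | yes b<x rewrite removeFirstAbove-> xs b<x with z∈
...   | here refl  = λ z∈xs → <-irrefl refl (All.lookup x<xs z∈xs)
...   | there z∈xs = λ _ → <⇒≱ (All.lookup x<xs z∈xs) (least (here refl) b<x)
removeFirstAbove-removes b {x ∷ xs} (x<xs ∷ s) z∈ (b<z , least) | no b≮x
  rewrite removeFirstAbove-≤ xs (≮⇒≥ b≮x) with z∈
... | here refl  = contradiction b<z b≮x
... | there z∈xs = λ
  { (here refl) → b≮x b<z
  ; (there z∈′) → removeFirstAbove-removes b s z∈xs (b<z , least ∘ there) z∈′ }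

removeFirstAbove-keeps-≤ : ∀ b V {y} → y ∈ V → y ≤ b → y ∈ removeFirstAbove b V
removeFirstAbove-keeps-≤ b (x ∷ xs) y∈ y≤b with b <? x
... | yes b<x rewrite removeFirstAbove-> xs b<x with y∈
...   | here refl  = contradiction b<x (≤⇒≯ y≤b)
...   | there y∈xs = y∈xs
removeFirstAbove-keeps-≤ b (x ∷ xs) y∈ y≤b | no b≮x rewrite removeFirstAbove-≤ xs (≮⇒≥ b≮x) with y∈
... | here y≡x   = here y≡x
... | there y∈xs = there (removeFirstAbove-keeps-≤ b xs y∈xs y≤b)

removeFirstAbove-keeps-> : ∀ b {V y z} → Sorted V → y ∈ V → b < y → y < z → z ∈ V →
  z ∈ removeFirstAbove b V
removeFirstAbove-keeps-> b {V} {z = z} s y∈ b<y y<z z∈ with z ∈? removeFirstAbove b V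
... | yes z∈′ = z∈′
... | no z∉′  = contradiction (proj₂ (removeFirstAbove-removed b s z∈ z∉′) y∈ b<y) (<⇒≱ y<z)

unpaired-⊆ : ∀ A B → unpaired A B ⊆ A
unpaired-⊆ A []      = λ y∈ → y∈
unpaired-⊆ A (b ∷ B) = unpaired-⊆ A B ∘ removeFirstAbove-⊆ b (unpaired A B)

unpaired-sorted : ∀ {A} B → Sorted A → Sorted (unpaired A B)
unpaired-sorted []      s = s
unpaired-sorted (b ∷ B) s = removeFirstAbove-sorted b (unpaired-sorted B s)

unpaired-keeps-≤ : ∀ A B {y} → All (y ≤_) B → y ∈ A → y ∈ unpaired A B
unpaired-keeps-≤ A []      []          y∈ = y∈
unpaired-keeps-≤ A (b ∷ B) (y≤b ∷ y≤B) y∈ =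
  removeFirstAbove-keeps-≤ b (unpaired A B) (unpaired-keeps-≤ A B y≤B y∈) y≤b

suc-∉-unpaired : ∀ {A} B {b} → Sorted A → b ∈ B → suc b ∉ unpaired A B
suc-∉-unpaired (c ∷ B) sA (there b∈B) b+1∈ =
  suc-∉-unpaired B sA b∈B (removeFirstAbove-⊆ c _ b+1∈)
suc-∉-unpaired (c ∷ B) sA (here refl) c+1∈ =
  removeFirstAbove-removes c (unpaired-sorted B sA) (removeFirstAbove-⊆ c _ c+1∈)
    (n<1+n c , λ _ c<y → c<y) c+1∈

-- The partner c of y+1 is y, since c < y would have been paired with the unpaired y instead.
paired-run : ∀ {A} B → Sorted A → Sorted B → ∀ t y → y ∈ unpaired A B →
  All (_∈ A) (run (suc y) t) → All (_∉ unpaired A B) (run (suc y) t) → All (_∈ B) (run y t)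
paired-run B sA sB zero y _ _ _ = []
paired-run [] sA sB (suc t) y _ (y+1∈A ∷ _) (y+1∉U ∷ _) = contradiction y+1∈A y+1∉U
paired-run {A} (c ∷ B) sA (c<B ∷ sB) (suc t) y y∈U (y+1∈A ∷ run∈A) (y+1∉U ∷ run∉U)
  with suc y ∈? unpaired A B
... | yes y+1∈U′ = here (sym c≡y) ∷ All.map there (paired-run B sA sB t (suc y) y+1∈U′ run∈A run∉U′)
  where
  sU′ : Sorted (unpaired A B)
  sU′ = unpaired-sorted B sA
  least : LeastAbove c (unpaired A B) (suc y)
  least = removeFirstAbove-removed c sU′ y+1∈U′ y+1∉U
  c≡y : c ≡ y
  c≡y = ≤-antisym (≤-pred (proj₁ least))
          (≮⇒≥ (λ c<y → 1+n≰n (proj₂ least (removeFirstAbove-⊆ c _ y∈U) c<y)))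
  run∉U′ : All (_∉ unpaired A B) (run (suc (suc y)) t)
  run∉U′ = All.zipWith (λ (y+2≤z , z∉U) z∈U′ →
             z∉U (removeFirstAbove-keeps-> c sU′ y+1∈U′ (proj₁ least) y+2≤z z∈U′))
           (run-≥ (suc (suc y)) t , run∉U)
... | no y+1∉U′ = All.map there (paired-run B sA sB (suc t) y y∈U′ (y+1∈A ∷ run∈A) run∉U′)
  where
  sU′ : Sorted (unpaired A B)
  sU′ = unpaired-sorted B sA
  y∈U′ : y ∈ unpaired A B
  y∈U′ = removeFirstAbove-⊆ c _ y∈U
  c<y : c < y
  c<y = All.lookup c<B (All.head (paired-run B sA sB 1 y y∈U′ (y+1∈A ∷ []) (y+1∉U′ ∷ [])))
  run∉U′ : All (_∉ unpaired A B) (run (suc y) (suc t))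
  run∉U′ = All.zipWith (λ (y+1≤z , z∉U) z∈U′ →
             z∉U (removeFirstAbove-keeps-> c sU′ y∈U′ c<y y+1≤z z∈U′))
           (run-≥ (suc y) (suc t) , y+1∉U ∷ run∉U)

maxList : List ℕ → ℕ
maxList = foldr _⊔_ 0

≤-maxList : ∀ L {y} → y ∈ L → y ≤ maxList L
≤-maxList (x ∷ L) (here refl) = m≤m⊔n x (maxList L)
≤-maxList (x ∷ L) (there y∈)  = ≤-trans (≤-maxList L y∈) (m≤n⊔m x (maxList L))

maxList-∈ : ∀ u us → maxList (u ∷ us) ∈ u ∷ us
maxList-∈ u []       = here (⊔-identityʳ u)
maxList-∈ u (v ∷ vs) with ⊔-sel u (maxList (v ∷ vs))
... | inj₁ eq = here eq
... | inj₂ eq = there (subst (_∈ v ∷ vs) (sym eq) (maxList-∈ v vs))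

shiftLen-run : ∀ fuel a A → All (_∈ A) (run (suc a) (shiftLen fuel a A))
shiftLen-run zero       a A = []
shiftLen-run (suc fuel) a A with suc a ∈? A
... | yes a+1∈ = a+1∈ ∷ shiftLen-run fuel (suc a) A
... | no _     = []

shiftLen-stops : ∀ fuel a A → shiftLen fuel a A ≡ fuel ⊎ suc (a + shiftLen fuel a A) ∉ A
shiftLen-stops zero       a A = inj₁ refl
shiftLen-stops (suc fuel) a A with suc a ∈? A
... | no a+1∉ rewrite +-identityʳ a = inj₂ a+1∉
... | yes _ rewrite +-suc a (shiftLen fuel (suc a) A) with shiftLen-stops fuel (suc a) A
...   | inj₁ eq = inj₁ (cong suc eq)
...   | inj₂ ∉A = inj₂ ∉A

removeElt-≡ : ∀ a xs → removeElt a (a ∷ xs) ≡ xs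
removeElt-≡ a xs rewrite dec-true (a ≟ a) refl = refl

removeElt-≢ : ∀ {a x} xs → x ≢ a → removeElt a (x ∷ xs) ≡ x ∷ removeElt a xs
removeElt-≢ {a} {x} xs x≢a rewrite dec-false (x ≟ a) x≢a = refl

removeElt-⊆ : ∀ a L → removeElt a L ⊆ L
removeElt-⊆ a []       z∈ = z∈
removeElt-⊆ a (x ∷ xs) z∈ with x ≟ a
... | yes refl rewrite removeElt-≡ x xs = there z∈
... | no x≢a rewrite removeElt-≢ xs x≢a with z∈
...   | here z≡x  = here z≡x
...   | there z∈′ = there (removeElt-⊆ a xs z∈′)

removeElt-sorted : ∀ a {L} → Sorted L → Sorted (removeElt a L)
removeElt-sorted a {[]}     []           = []
removeElt-sorted a {x ∷ xs} (x<xs ∷ s) with x ≟ a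
... | yes refl rewrite removeElt-≡ x xs = s
... | no x≢a rewrite removeElt-≢ xs x≢a = anti-mono (removeElt-⊆ a xs) x<xs ∷ removeElt-sorted a s

length-removeElt : ∀ {a L} → a ∈ L → suc (length (removeElt a L)) ≡ length L
length-removeElt {a} {x ∷ xs} a∈ with x ≟ a
... | yes refl rewrite removeElt-≡ x xs = refl
... | no x≢a rewrite removeElt-≢ xs x≢a with a∈
...   | here a≡x  = contradiction (sym a≡x) x≢a
...   | there a∈′ = cong suc (length-removeElt a∈′)

removeElt-++ : ∀ {a} P R → All (_< a) P → removeElt a (P ++ a ∷ R) ≡ P ++ R
removeElt-++ {a} []      R []           = removeElt-≡ a R
removeElt-++     (x ∷ P) R (x<a ∷ P<a) =
  trans (removeElt-≢ (P ++ _) (<⇒≢ x<a)) (cong (x ∷_) (removeElt-++ P R P<a))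

insertSorted-< : ∀ {v x} xs → x < v → insertSorted v (x ∷ xs) ≡ x ∷ insertSorted v xs
insertSorted-< {v} {x} xs x<v rewrite dec-true (x <? v) x<v = refl

insertSorted-≤ : ∀ {v x} xs → v ≤ x → insertSorted v (x ∷ xs) ≡ v ∷ x ∷ xs
insertSorted-≤ {v} {x} xs v≤x rewrite dec-false (x <? v) (≤⇒≯ v≤x) = refl

insertSorted-++ : ∀ {v} P R → All (_< v) P → insertSorted v (P ++ R) ≡ P ++ insertSorted v R
insertSorted-++ []      R []           = refl
insertSorted-++ (x ∷ P) R (x<v ∷ P<v) =
  trans (insertSorted-< (P ++ R) x<v) (cong (x ∷_) (insertSorted-++ P R P<v))

insertSorted-head : ∀ {v} R → All (v ≤_) R → insertSorted v R ≡ v ∷ R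
insertSorted-head []      _           = refl
insertSorted-head (x ∷ R) (v≤x ∷ _) = insertSorted-≤ R v≤x

length-insertSorted : ∀ v L → length (insertSorted v L) ≡ suc (length L)
length-insertSorted v []       = refl
length-insertSorted v (x ∷ xs) with x <? v
... | yes x<v rewrite insertSorted-< xs x<v = cong suc (length-insertSorted v xs)
... | no x≮v  rewrite insertSorted-≤ xs (≮⇒≥ x≮v) = refl

All-insertSorted⁺ : ∀ {P : ℕ → Set} {v} L → P v → All P L → All P (insertSorted v L)
All-insertSorted⁺ []       pv []           = pv ∷ []
All-insertSorted⁺ {v = v} (x ∷ xs) pv (px ∷ pxs) with x <? v
... | yes x<v rewrite insertSorted-< xs x<v = px ∷ All-insertSorted⁺ xs pv pxs
... | no x≮v  rewrite insertSorted-≤ xs (≮⇒≥ x≮v) = pv ∷ px ∷ pxs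

All-insertSorted⁻ : ∀ {P : ℕ → Set} {v} L → All P (insertSorted v L) → P v × All P L
All-insertSorted⁻ []       (pv ∷ []) = pv , []
All-insertSorted⁻ {v = v} (x ∷ xs) ps with x <? v
... | yes x<v rewrite insertSorted-< xs x<v with px ∷ ps′ ← ps
      with pv , pxs ← All-insertSorted⁻ xs ps′ = pv , px ∷ pxs
... | no x≮v  rewrite insertSorted-≤ xs (≮⇒≥ x≮v) with pv ∷ pxs ← ps = pv , pxs

insertSorted-sorted : ∀ {v L} → Sorted L → v ∉ L → Sorted (insertSorted v L)
insertSorted-sorted {v} {[]}     []           _  = [] ∷ []
insertSorted-sorted {v} {x ∷ xs} (x<xs ∷ s) v∉ with x <? v
... | yes x<v rewrite insertSorted-< xs x<v =
  All-insertSorted⁺ xs x<v x<xs ∷ insertSorted-sorted s (v∉ ∘ there)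
... | no x≮v rewrite insertSorted-≤ xs (≮⇒≥ x≮v) = (v<x ∷ All.map (<-trans v<x) x<xs) ∷ x<xs ∷ s
  where
  v<x : v < x
  v<x = ≤∧≢⇒< (≮⇒≥ x≮v) (v∉ ∘ here)

insertSorted-duplicate : ∀ {v L} → Sorted L → v ∈ L → ∃[ U ] ∃[ W ] insertSorted v L ≡ U ++ v ∷ v ∷ W
insertSorted-duplicate {v} {x ∷ xs} s@(_ ∷ s′) v∈ with x <? v
... | yes x<v rewrite insertSorted-< xs x<v
  with U , W , eq ← insertSorted-duplicate s′ (Any.tail (>⇒≢ x<v) v∈) = x ∷ U , W , cong (x ∷_) eq
... | no x≮v rewrite insertSorted-≤ xs (≮⇒≥ x≮v)
  with refl ← ∈-sorted-≤-head s v∈ (≮⇒≥ x≮v) = [] , xs , refl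

-- The raising operators preserve RF_n(w)

length-++₃ : ∀ (P M S : List ℕ) → length (P ++ M ++ S) ≡ length P + (length M + length S)
length-++₃ P M S = trans (length-++ P) (cong (length P +_) (length-++ M))

reduced-no-repeat : ∀ {w} U v W → ¬ IsReducedWord w (U ++ v ∷ v ∷ W)
reduced-no-repeat {w} U v W (valid , represents , minimal) =
  <⇒≱ shorter (minimal (U ++ W) valid′ represents′)
  where
  valid′ : ValidWord (U ++ W)
  valid′ = ++⁺ (++⁻ˡ U valid) (All.tail (All.tail (++⁻ʳ U valid)))
  represents′ : Represents (U ++ W) w
  represents′ x 1≤x = begin
    perm (U ++ W) x                   ≡⟨ perm-++ U W x ⟩
    perm U (perm W x)                 ≡⟨ cong (perm U) (sym (swap-involutive v (perm W x))) ⟩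
    perm U (perm (v ∷ v ∷ W) x)       ≡⟨ sym (perm-++ U (v ∷ v ∷ W) x) ⟩
    perm (U ++ v ∷ v ∷ W) x           ≡⟨ represents x 1≤x ⟩
    w x                               ∎
    where open ≡-Reasoning
  shorter : length (U ++ W) < length (U ++ v ∷ v ∷ W)
  shorter rewrite length-++ U {W} | length-++ U {v ∷ v ∷ W} =
    +-monoʳ-< (length U) (<-trans (n<1+n (length W)) (n<1+n (suc (length W))))

reduced-replace : ∀ {w} Pre M M′ Suf → IsReducedWord w (Pre ++ M ++ Suf) → ValidWord M′ →
  (∀ x → perm M′ x ≡ perm M x) → length M′ ≡ length M → IsReducedWord w (Pre ++ M′ ++ Suf)
reduced-replace {w} Pre M M′ Suf (valid , represents , minimal) valid-M′ perm≡ length≡ =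
  valid′ , represents′ , minimal′
  where
  valid′ : ValidWord (Pre ++ M′ ++ Suf)
  valid′ = ++⁺ (++⁻ˡ Pre valid) (++⁺ valid-M′ (++⁻ʳ M (++⁻ʳ Pre valid)))
  represents′ : Represents (Pre ++ M′ ++ Suf) w
  represents′ x 1≤x = begin
    perm (Pre ++ M′ ++ Suf) x         ≡⟨ perm-++₃ Pre M′ Suf x ⟩
    perm Pre (perm M′ (perm Suf x))   ≡⟨ cong (perm Pre) (perm≡ (perm Suf x)) ⟩
    perm Pre (perm M (perm Suf x))    ≡⟨ sym (perm-++₃ Pre M Suf x) ⟩
    perm (Pre ++ M ++ Suf) x          ≡⟨ represents x 1≤x ⟩
    w x                               ∎
    where open ≡-Reasoning
  length-same : length (Pre ++ M′ ++ Suf) ≡ length (Pre ++ M ++ Suf)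
  length-same rewrite length-++₃ Pre M′ Suf | length-++₃ Pre M Suf | length≡ = refl
  minimal′ : ∀ u → ValidWord u → Represents u w → length (Pre ++ M′ ++ Suf) ≤ length u
  minimal′ u valid-u represents-u = subst (_≤ length u) (sym length-same) (minimal u valid-u represents-u)

perm-raise : ∀ P Q Bl Bh a s x → All (suc (a + s) <_) Q → All (λ d → suc d < a) Bl →
  perm (P ++ run (suc a) s ++ Q) (perm (Bl ++ run a s ++ (a + s) ∷ Bh) x) ≡
  perm (P ++ run a (suc s) ++ Q) (perm (Bl ++ run a s ++ Bh) x)
perm-raise P Q Bl Bh a s x Q> Bl< = begin
  perm (P ++ R′ ++ Q) (perm (Bl ++ X ++ (a + s) ∷ Bh) x)
    ≡⟨ perm-++₃ P R′ Q _ ⟩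
  perm P (perm R′ (perm Q (perm (Bl ++ X ++ (a + s) ∷ Bh) x)))
    ≡⟨ cong (perm P ∘ perm R′ ∘ perm Q) (perm-++₃ Bl X ((a + s) ∷ Bh) x) ⟩
  perm P (perm R′ (perm Q (perm Bl (perm X (swap (a + s) y)))))
    ≡⟨ cong (perm P) (pass R′ (run-distant-above (suc a) s Q>)
                              (run-distant-below (suc a) s (All.map m<n⇒m<1+n Bl<))) ⟩
  perm P (perm Q (perm Bl (perm R′ (perm X (swap (a + s) y)))))
    ≡⟨ cong (perm P ∘ perm Q ∘ perm Bl ∘ perm R′) last-letter ⟩
  perm P (perm Q (perm Bl (perm R′ (perm R y))))
    ≡⟨ cong (perm P ∘ perm Q ∘ perm Bl) (sym (perm-run-shift s a y)) ⟩
  perm P (perm Q (perm Bl (perm R (perm X y))))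
    ≡⟨ cong (perm P) (sym (pass R (run-distant-above a (suc s) (subst (λ m → All (m <_) Q) (sym (+-suc a s)) Q>))
                                   (run-distant-below a (suc s) Bl<))) ⟩
  perm P (perm R (perm Q (perm Bl (perm X y))))
    ≡⟨ cong (perm P ∘ perm R ∘ perm Q) (sym (perm-++₃ Bl X Bh x)) ⟩
  perm P (perm R (perm Q (perm (Bl ++ X ++ Bh) x)))
    ≡⟨ sym (perm-++₃ P R Q _) ⟩
  perm (P ++ R ++ Q) (perm (Bl ++ X ++ Bh) x) ∎
  where
  open ≡-Reasoning
  R′ R X : List ℕ
  R′ = run (suc a) s
  R  = run a (suc s)
  X  = run a s
  y : ℕ
  y = perm Bh x
  pass : ∀ T {z} → AllDistant T Q → AllDistant T Bl →
    perm T (perm Q (perm Bl z)) ≡ perm Q (perm Bl (perm T z))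
  pass T {z} TQ TBl = trans (perm-comm T Q (perm Bl z) TQ) (cong (perm Q) (perm-comm T Bl z TBl))
  last-letter : perm X (swap (a + s) y) ≡ perm R y
  last-letter = trans (sym (perm-++ X ((a + s) ∷ []) y)) (cong (λ L → perm L y) (sym (run-∷ʳ a s)))

∈-run-∷ : ∀ a t Bh → a ∈ run a t ++ (a + t) ∷ Bh
∈-run-∷ a zero    Bh = here (sym (+-identityʳ a))
∈-run-∷ a (suc t) Bh = here refl

module RaiseStep (A B : List ℕ) {u us} (U≡ : unpaired A B ≡ u ∷ us) where

  a s v : ℕ
  a = maxList (u ∷ us)
  s = shiftLen (length A) a A
  v = a + s

  A′ B′ : List ℕ
  A′ = removeElt a A
  B′ = insertSorted v B

  raisePair≡ : raisePair B A ≡ just (B′ , A′)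
  raisePair≡ rewrite U≡ = refl

  a∈U : a ∈ unpaired A B
  a∈U = subst (a ∈_) (sym U≡) (maxList-∈ u us)

  unpaired-≤-a : ∀ {y} → y ∈ unpaired A B → y ≤ a
  unpaired-≤-a {y} y∈ = ≤-maxList (u ∷ us) (subst (y ∈_) U≡ y∈)

  a∈A : a ∈ A
  a∈A = unpaired-⊆ A B a∈U

  module _ (sA : Sorted A) (sB : Sorted B) where
    private
      run∈A : All (_∈ A) (run a (suc s))
      run∈A = a∈A ∷ shiftLen-run (length A) a A

      splitA : ∃[ P ] ∃[ Q ] (A ≡ P ++ run a (suc s) ++ Q × All (_< a) P × All (a + suc s ≤_) Q)
      splitA = sorted-split a (suc s) sA run∈A
      P Q : List ℕ
      P = proj₁ splitA
      Q = proj₁ (proj₂ splitA)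
      A≡ : A ≡ P ++ run a (suc s) ++ Q
      A≡ = proj₁ (proj₂ (proj₂ splitA))
      P<a : All (_< a) P
      P<a = proj₁ (proj₂ (proj₂ (proj₂ splitA)))
      Q≥ : All (a + suc s ≤_) Q
      Q≥ = proj₂ (proj₂ (proj₂ (proj₂ splitA)))

      s<length : s < length A
      s<length = begin
        suc s                                      ≤⟨ m≤m+n (suc s) (length Q) ⟩
        suc s + length Q                           ≤⟨ m≤n+m _ (length P) ⟩
        length P + (suc s + length Q)              ≡⟨ cong (λ m → length P + (m + length Q)) (sym (length-run a (suc s))) ⟩
        length P + (length (run a (suc s)) + length Q) ≡⟨ sym (length-++₃ P (run a (suc s)) Q) ⟩
        length (P ++ run a (suc s) ++ Q)           ≡⟨ cong length (sym A≡) ⟩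
        length A                                   ∎
        where open ≤-Reasoning

      v+1∉A : suc v ∉ A
      v+1∉A with shiftLen-stops (length A) a A
      ... | inj₁ s≡ = contradiction s≡ (<⇒≢ s<length)
      ... | inj₂ ∉A = ∉A

      Q> : All (suc v <_) Q
      Q> = All.tabulate λ {q} q∈ → ≤∧≢⇒< (subst (_≤ q) (+-suc a s) (All.lookup Q≥ q∈))
             (λ v+1≡q → v+1∉A (subst (_∈ A) (sym v+1≡q)
                                 (subst (q ∈_) (sym A≡) (∈-++⁺ʳ P (∈-++⁺ʳ (run a (suc s)) q∈)))))

      run∈B : All (_∈ B) (run a s)
      run∈B = paired-run B sA sB s a a∈U (shiftLen-run (length A) a A)
                (All.map (λ a<z z∈U → <⇒≱ a<z (unpaired-≤-a z∈U)) (run-≥ (suc a) s))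

      splitB : ∃[ Bl ] ∃[ Bh ] (B ≡ Bl ++ run a s ++ Bh × All (_< a) Bl × All (a + s ≤_) Bh)
      splitB = sorted-split a s sB run∈B
      Bl Bh : List ℕ
      Bl = proj₁ splitB
      Bh = proj₁ (proj₂ splitB)
      B≡ : B ≡ Bl ++ run a s ++ Bh
      B≡ = proj₁ (proj₂ (proj₂ splitB))
      Bl<a : All (_< a) Bl
      Bl<a = proj₁ (proj₂ (proj₂ (proj₂ splitB)))
      Bh≥ : All (v ≤_) Bh
      Bh≥ = proj₂ (proj₂ (proj₂ (proj₂ splitB)))

      Bl+1<a : All (λ b → suc b < a) Bl
      Bl+1<a = All.tabulate λ {b} b∈ → ≤∧≢⇒< (All.lookup Bl<a b∈)
                 (λ b+1≡a → suc-∉-unpaired B sA (subst (b ∈_) (sym B≡) (∈-++⁺ˡ b∈))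
                              (subst (_∈ unpaired A B) (sym b+1≡a) a∈U))

      A′≡ : A′ ≡ P ++ run (suc a) s ++ Q
      A′≡ = trans (cong (removeElt a) A≡) (removeElt-++ P _ P<a)

      B′≡ : B′ ≡ Bl ++ run a s ++ v ∷ Bh
      B′≡ = begin
        insertSorted v B                           ≡⟨ cong (insertSorted v) B≡ ⟩
        insertSorted v (Bl ++ run a s ++ Bh)       ≡⟨ insertSorted-++ Bl _ (All.map (λ b<a → <-≤-trans b<a (m≤m+n a s)) Bl<a) ⟩
        Bl ++ insertSorted v (run a s ++ Bh)       ≡⟨ cong (Bl ++_) (insertSorted-++ (run a s) Bh (run-< a s)) ⟩
        Bl ++ run a s ++ insertSorted v Bh         ≡⟨ cong (λ L → Bl ++ run a s ++ L) (insertSorted-head Bh Bh≥) ⟩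
        Bl ++ run a s ++ v ∷ Bh                    ∎
        where open ≡-Reasoning

    A′-sorted : Sorted A′
    A′-sorted = removeElt-sorted a sA

    a∈B′ : a ∈ B′
    a∈B′ = subst (a ∈_) (sym B′≡) (∈-++⁺ʳ Bl (∈-run-∷ a s Bh))

    perm-preserved : ∀ x → perm (A′ ++ B′) x ≡ perm (A ++ B) x
    perm-preserved x = begin
      perm (A′ ++ B′) x                  ≡⟨ perm-++ A′ B′ x ⟩
      perm A′ (perm B′ x)                ≡⟨ cong₂ (λ L M → perm L (perm M x)) A′≡ B′≡ ⟩
      perm (P ++ run (suc a) s ++ Q) (perm (Bl ++ run a s ++ v ∷ Bh) x)
                                         ≡⟨ perm-raise P Q Bl Bh a s x Q> Bl+1<a ⟩
      perm (P ++ run a (suc s) ++ Q) (perm (Bl ++ run a s ++ Bh) x)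
                                         ≡⟨ sym (cong₂ (λ L M → perm L (perm M x)) A≡ B≡) ⟩
      perm A (perm B x)                  ≡⟨ sym (perm-++ A B x) ⟩
      perm (A ++ B) x                    ∎
      where open ≡-Reasoning

    length-preserved : length (A′ ++ B′) ≡ length (A ++ B)
    length-preserved = begin
      length (A′ ++ B′)              ≡⟨ length-++ A′ ⟩
      length A′ + length B′          ≡⟨ cong (length A′ +_) (length-insertSorted v B) ⟩
      length A′ + suc (length B)     ≡⟨ +-suc (length A′) (length B) ⟩
      suc (length A′) + length B     ≡⟨ cong (_+ length B) (length-removeElt a∈A) ⟩
      length A + length B            ≡⟨ sym (length-++ A) ⟩
      length (A ++ B)                ∎
      where open ≡-Reasoning

data Adjacent : ∀ {n} → ℕ → List ℕ → List ℕ → Factorization n → Set where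
  adjacent-here  : ∀ {n B A} {rest : Factorization n} → Adjacent zero B A (B ∷ A ∷ rest)
  adjacent-there : ∀ {n k B A x} {f : Factorization n} → Adjacent k B A f → Adjacent (suc k) B A (x ∷ f)

adjacent : ∀ {n} (f : Factorization n) k → suc k < n → ∃[ B ] ∃[ A ] Adjacent k B A f
adjacent (B ∷ A ∷ rest) zero    _          = B , A , adjacent-here
adjacent (x ∷ f)        (suc k) (s≤s k+1<n) with B , A , p ← adjacent f k k+1<n = B , A , adjacent-there p

replace : ∀ {n k B A} {f : Factorization n} → Adjacent k B A f → List ℕ → List ℕ → Factorization n
replace (adjacent-here {rest = rest}) B′ A′ = B′ ∷ A′ ∷ rest
replace (adjacent-there {x = x} p)    B′ A′ = x ∷ replace p B′ A′

replace-self : ∀ {n k B A} {f : Factorization n} (p : Adjacent k B A f) → replace p B A ≡ f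
replace-self adjacent-here      = refl
replace-self (adjacent-there p) = cong (_ ∷_) (replace-self p)

replace-adjacent : ∀ {n k B A} {f : Factorization n} (p : Adjacent k B A f) B′ A′ →
  Adjacent k B′ A′ (replace p B′ A′)
replace-adjacent adjacent-here      B′ A′ = adjacent-here
replace-adjacent (adjacent-there p) B′ A′ = adjacent-there (replace-adjacent p B′ A′)

replace-replace : ∀ {n k B A} {f : Factorization n} (p : Adjacent k B A f) B′ A′ →
  replace (replace-adjacent p B′ A′) B A ≡ f
replace-replace adjacent-here      B′ A′ = refl
replace-replace (adjacent-there p) B′ A′ = cong (_ ∷_) (replace-replace p B′ A′)

raiseAt-just : ∀ {n k B A B′ A′} {f : Factorization n} (p : Adjacent k B A f) →
  raisePair B A ≡ just (B′ , A′) → raiseAt k f ≡ just (replace p B′ A′)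
raiseAt-just adjacent-here      eq rewrite eq = refl
raiseAt-just (adjacent-there p) eq rewrite raiseAt-just p eq = refl

raiseAt-nothing : ∀ {n k B A} {f : Factorization n} (p : Adjacent k B A f) →
  raisePair B A ≡ nothing → raiseAt k f ≡ nothing
raiseAt-nothing adjacent-here      eq rewrite eq = refl
raiseAt-nothing (adjacent-there p) eq rewrite raiseAt-nothing p eq = refl

word-replace : ∀ {n k B A} {f : Factorization n} (p : Adjacent k B A f) →
  ∃[ Pre ] ∃[ Suf ] (∀ B′ A′ → word (replace p B′ A′) ≡ Pre ++ (A′ ++ B′) ++ Suf)
word-replace (adjacent-here {rest = rest}) =
  word rest , [] , λ B′ A′ → trans (++-assoc (word rest) A′ B′) (cong (word rest ++_) (sym (++-identityʳ _)))
word-replace (adjacent-there {x = x} p) with Pre , Suf , word≡ ← word-replace p =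
  Pre , Suf ++ x , λ B′ A′ → begin
    word (replace p B′ A′) ++ x        ≡⟨ cong (_++ x) (word≡ B′ A′) ⟩
    (Pre ++ (A′ ++ B′) ++ Suf) ++ x    ≡⟨ ++-assoc Pre _ x ⟩
    Pre ++ ((A′ ++ B′) ++ Suf) ++ x    ≡⟨ cong (Pre ++_) (++-assoc (A′ ++ B′) Suf x) ⟩
    Pre ++ (A′ ++ B′) ++ Suf ++ x      ∎
  where open ≡-Reasoning

All-adjacent : ∀ {P : List ℕ → Set} {n k B A} {f : Factorization n} → Adjacent k B A f →
  VAll.All P f → P B × P A
All-adjacent adjacent-here      (pB VAll.∷ pA VAll.∷ _) = pB , pA
All-adjacent (adjacent-there p) (_ VAll.∷ ps)           = All-adjacent p ps

All-replace : ∀ {P : List ℕ → Set} {n k B A} {f : Factorization n} (p : Adjacent k B A f) →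
  VAll.All P f → ∀ {B′ A′} → P B′ → P A′ → VAll.All P (replace p B′ A′)
All-replace adjacent-here      (_ VAll.∷ _ VAll.∷ ps) pB′ pA′ = pB′ VAll.∷ pA′ VAll.∷ ps
All-replace (adjacent-there p) (q VAll.∷ ps)           pB′ pA′ = q VAll.∷ All-replace p ps pB′ pA′

RF-sorted : ∀ {n w k B A} {f : Factorization n} → Adjacent k B A f → RF n w f → Sorted B × Sorted A
RF-sorted p (increasing , _) with incB , incA ← All-adjacent p increasing =
  increasing⇒sorted incB , increasing⇒sorted incA

RF-valid : ∀ {n w k B A} {f : Factorization n} → Adjacent k B A f → RF n w f → ValidWord A × ValidWord B
RF-valid {B = B} {A} {f} p (_ , valid , _) with Pre , Suf , word≡ ← word-replace p =
  ++⁻ˡ A valid-AB , ++⁻ʳ A valid-AB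
  where
  valid-AB : ValidWord (A ++ B)
  valid-AB = ++⁻ˡ (A ++ B) (++⁻ʳ Pre (subst ValidWord (trans (cong word (sym (replace-self p))) (word≡ B A)) valid))

RF-raise : ∀ {n w k B A u us} {f : Factorization n} (p : Adjacent k B A f) (U≡ : unpaired A B ≡ u ∷ us) →
  RF n w f → RF n w (replace p (RaiseStep.B′ A B U≡) (RaiseStep.A′ A B U≡))
RF-raise {w = w} {B = B} {A} p U≡ rf@(increasing , reduced) =
  All-replace p increasing (AllPairs⇒Linked B′-sorted) (AllPairs⇒Linked (A′-sorted sA sB)) ,
  subst (IsReducedWord w) (sym (word≡ B′ A′)) reduced′
  where
  open RaiseStep A B U≡
  sB : Sorted B
  sB = proj₁ (RF-sorted p rf)
  sA : Sorted A
  sA = proj₂ (RF-sorted p rf)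
  vA : ValidWord A
  vA = proj₁ (RF-valid p rf)
  vB : ValidWord B
  vB = proj₂ (RF-valid p rf)
  Pre Suf : List ℕ
  Pre = proj₁ (word-replace p)
  Suf = proj₁ (proj₂ (word-replace p))
  word≡ : ∀ B′ A′ → word (replace p B′ A′) ≡ Pre ++ (A′ ++ B′) ++ Suf
  word≡ = proj₂ (proj₂ (word-replace p))
  valid′ : ValidWord (A′ ++ B′)
  valid′ = ++⁺ (anti-mono (removeElt-⊆ a A) vA)
               (All-insertSorted⁺ B (≤-trans (All.lookup vA a∈A) (m≤m+n a s)) vB)
  reduced′ : IsReducedWord w (Pre ++ (A′ ++ B′) ++ Suf)
  reduced′ = reduced-replace Pre (A ++ B) (A′ ++ B′) Suf
    (subst (IsReducedWord w) (trans (cong word (sym (replace-self p))) (word≡ B A)) reduced)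
    valid′ (perm-preserved sA sB) (length-preserved sA sB)
  -- v ∈ B would put s_v s_v into the reduced word
  B′-sorted : Sorted B′
  B′-sorted with v ∈? B
  ... | no v∉B = insertSorted-sorted sB v∉B
  ... | yes v∈B with U , W , B′≡ ← insertSorted-duplicate sB v∈B =
    ⊥-elim (reduced-no-repeat (Pre ++ A′ ++ U) v (W ++ Suf) (subst (IsReducedWord w) reassoc reduced′))
    where
    reassoc : Pre ++ (A′ ++ B′) ++ Suf ≡ (Pre ++ A′ ++ U) ++ v ∷ v ∷ W ++ Suf
    reassoc = begin
      Pre ++ (A′ ++ B′) ++ Suf                   ≡⟨ cong (λ L → Pre ++ (A′ ++ L) ++ Suf) B′≡ ⟩
      Pre ++ (A′ ++ U ++ v ∷ v ∷ W) ++ Suf       ≡⟨ cong (Pre ++_) (++-assoc A′ _ Suf) ⟩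
      Pre ++ A′ ++ (U ++ v ∷ v ∷ W) ++ Suf       ≡⟨ cong (λ L → Pre ++ A′ ++ L) (++-assoc U _ Suf) ⟩
      Pre ++ A′ ++ U ++ v ∷ v ∷ W ++ Suf         ≡⟨ cong (Pre ++_) (sym (++-assoc A′ U _)) ⟩
      Pre ++ (A′ ++ U) ++ v ∷ v ∷ W ++ Suf       ≡⟨ sym (++-assoc Pre (A′ ++ U) _) ⟩
      (Pre ++ A′ ++ U) ++ v ∷ v ∷ W ++ Suf       ∎
      where open ≡-Reasoning

-- Flags

HeadBound : (ℕ → ℕ) → ℕ → List ℕ → Set
HeadBound φ l []      = ⊤
HeadBound φ l (a ∷ _) = l ≤ φ a

FlaggedFrom : (ℕ → ℕ) → ℕ → ∀ {n} → Factorization n → Set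
FlaggedFrom φ l []       = ⊤
FlaggedFrom φ l (x ∷ xs) = HeadBound φ l x × FlaggedFrom φ (suc l) xs

FlaggedFrom⁺ : ∀ {φ n} l (f : Factorization n) →
  (∀ k a rest → lookup f k ≡ a ∷ rest → l + toℕ k ≤ φ a) → FlaggedFrom φ l f
FlaggedFrom⁺         l []      _     = tt
FlaggedFrom⁺ {φ} l (x ∷ f) bound = head-bound x (bound fzero) , FlaggedFrom⁺ (suc l) f tail-bound
  where
  head-bound : ∀ x → (∀ a rest → x ≡ a ∷ rest → l + 0 ≤ φ a) → HeadBound φ l x
  head-bound []         _ = tt
  head-bound (a ∷ rest) g = subst (_≤ φ a) (+-identityʳ l) (g a rest refl)
  tail-bound : ∀ k a rest → lookup f k ≡ a ∷ rest → suc l + toℕ k ≤ φ a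
  tail-bound k a rest eq = subst (_≤ φ a) (+-suc l (toℕ k)) (bound (fsuc k) a rest eq)

FlaggedFrom⁻ : ∀ {φ n} l (f : Factorization n) → FlaggedFrom φ l f →
  ∀ k a rest → lookup f k ≡ a ∷ rest → l + toℕ k ≤ φ a
FlaggedFrom⁻ {φ} l (x ∷ f) (hx , _)  fzero    a rest refl = subst (_≤ φ a) (sym (+-identityʳ l)) hx
FlaggedFrom⁻ {φ} l (x ∷ f) (_ , hf) (fsuc k) a rest eq =
  subst (_≤ φ a) (sym (+-suc l (toℕ k))) (FlaggedFrom⁻ (suc l) f hf k a rest eq)

FlaggedFrom-mono : ∀ {φ ψ n} l (f : Factorization n) →
  (∀ l′ x → l ≤ l′ → HeadBound φ l′ x → HeadBound ψ l′ x) → FlaggedFrom φ l f → FlaggedFrom ψ l f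
FlaggedFrom-mono l []      _ _          = tt
FlaggedFrom-mono l (x ∷ f) g (hx , hf) =
  g l x ≤-refl hx , FlaggedFrom-mono (suc l) f (λ l′ y l<l′ → g l′ y (<⇒≤ l<l′)) hf

FlaggedFrom-adjacent : ∀ {φ n k B A} {f : Factorization n} l → Adjacent k B A f → FlaggedFrom φ l f →
  HeadBound φ (l + k) B × HeadBound φ (l + suc k) A
FlaggedFrom-adjacent l adjacent-here (hB , hA , _) rewrite +-identityʳ l | +-comm l 1 = hB , hA
FlaggedFrom-adjacent {k = suc k} l (adjacent-there p) (_ , hf)
  rewrite +-suc l k | +-suc l (suc k) = FlaggedFrom-adjacent (suc l) p hf

FlaggedFrom-replace : ∀ {φ n k B A} {f : Factorization n} l (p : Adjacent k B A f) → FlaggedFrom φ l f →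
  ∀ {B′ A′} → HeadBound φ (l + k) B′ → HeadBound φ (l + suc k) A′ → FlaggedFrom φ l (replace p B′ A′)
FlaggedFrom-replace l adjacent-here (_ , _ , hr) hB′ hA′ rewrite +-identityʳ l | +-comm l 1 = hB′ , hA′ , hr
FlaggedFrom-replace {k = suc k} l (adjacent-there p) (hx , hf) hB′ hA′
  rewrite +-suc l k | +-suc l (suc k) = hx , FlaggedFrom-replace (suc l) p hf hB′ hA′

FlaggedFrom-replace⁻ : ∀ {φ n k B A} {f : Factorization n} l (p : Adjacent k B A f) {B′ A′} →
  FlaggedFrom φ l (replace p B′ A′) → HeadBound φ (l + k) B → HeadBound φ (l + suc k) A → FlaggedFrom φ l f
FlaggedFrom-replace⁻ {φ} l p {B′} {A′} fl hB hA =
  subst (FlaggedFrom φ l) (replace-replace p B′ A′) (FlaggedFrom-replace l (replace-adjacent p B′ A′) fl hB hA)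

FlaggedFrom-transfer : ∀ {φ ψ n k B A} {f : Factorization n} l → Adjacent k B A f →
  (∀ l′ x → l′ ≢ l + suc k → HeadBound φ l′ x → HeadBound ψ l′ x) →
  FlaggedFrom φ l f → HeadBound ψ (l + suc k) A → FlaggedFrom ψ l f
FlaggedFrom-transfer {f = B ∷ A ∷ rest} l adjacent-here g (hB , _ , hr) hA′ rewrite +-comm l 1 =
  g l B (<⇒≢ (n<1+n l)) hB , hA′ ,
  FlaggedFrom-mono (suc (suc l)) rest (λ l′ x l+2≤l′ → g l′ x (>⇒≢ (<-≤-trans (n<1+n (suc l)) l+2≤l′))) hr
FlaggedFrom-transfer {k = suc k} {f = x ∷ f} l (adjacent-there p) g (hx , hf) hA′
  rewrite +-suc l (suc k) =
  g l x (<⇒≢ (s≤s (m≤m+n l (suc k)))) hx , FlaggedFrom-transfer (suc l) p g hf hA′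

-e-≡ : ∀ φ i → (φ -e i) i ≡ φ i ∸ 1
-e-≡ φ i rewrite dec-true (i ≟ i) refl = refl

-e-≢ : ∀ φ {i l} → l ≢ i → (φ -e i) l ≡ φ l
-e-≢ φ {i} {l} l≢i rewrite dec-false (l ≟ i) l≢i = refl

-e-≤ : ∀ φ i l → (φ -e i) l ≤ φ l
-e-≤ φ i l with l ≟ i
... | yes refl = subst (_≤ φ l) (sym (-e-≡ φ l)) (m∸n≤m (φ l) 1)
... | no l≢i   = ≤-reflexive (-e-≢ φ l≢i)

<⇒≤∸1 : ∀ {m n} → m < n → m ≤ n ∸ 1
<⇒≤∸1 (s≤s m≤n) = m≤n

HeadBound-e : ∀ φ i l x → l ≢ φ i → HeadBound φ l x → HeadBound (φ -e i) l x
HeadBound-e φ i l []      _      _ = tt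
HeadBound-e φ i l (a ∷ _) l≢φi l≤φa with a ≟ i
... | yes refl = subst (l ≤_) (sym (-e-≡ φ a)) (<⇒≤∸1 (≤∧≢⇒< l≤φa l≢φi))
... | no a≢i   = subst (l ≤_) (sym (-e-≢ φ a≢i)) l≤φa

Flagged-e : ∀ {n} φ i (f : Factorization n) → n ≤ φ i ∸ 1 → Flagged φ f ⇔ Flagged (φ -e i) f
Flagged-e {n} φ i f n≤ = mk⇔ lower (λ fl k a rest eq → ≤-trans (fl k a rest eq) (-e-≤ φ i a))
  where
  lower : Flagged φ f → Flagged (φ -e i) f
  lower fl k a rest eq with a ≟ i
  ... | yes refl = subst (suc (toℕ k) ≤_) (sym (-e-≡ φ a)) (≤-trans (toℕ<n k) n≤)
  ... | no a≢i   = subst (suc (toℕ k) ≤_) (sym (-e-≢ φ a≢i)) (fl k a rest eq)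

∈⇒nonempty : ∀ {y : ℕ} {L} → y ∈ L → ∃[ u ] ∃[ us ] L ≡ u ∷ us
∈⇒nonempty {L = u ∷ us} _ = u , us , refl

empty-or-cons : (L : List ℕ) → L ≡ [] ⊎ ∃[ u ] ∃[ us ] L ≡ u ∷ us
empty-or-cons []       = inj₁ refl
empty-or-cons (u ∷ us) = inj₂ (u , us , refl)

raisePair-nothing : ∀ {B A} → unpaired A B ≡ [] → raisePair B A ≡ nothing
raisePair-nothing U≡ rewrite U≡ = refl

eIter-just : ∀ {n j m} {c c′ : Factorization n} → e j c ≡ just c′ → eIter j (suc m) c ≡ eIter j m c′
eIter-just eq rewrite eq = refl

eIter-nothing : ∀ {n j m} {c : Factorization n} → e j c ≡ nothing → eIter j (suc m) c ≡ nothing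
eIter-nothing eq rewrite eq = refl

HeadBound-removeElt : ∀ {φ l a} A → HeadBound φ l (removeElt a A) → l ≤ φ a → HeadBound φ l A
HeadBound-removeElt []      _ _ = tt
HeadBound-removeElt {a = a} (x ∷ A) hA′ l≤φa with x ≟ a
... | yes refl = l≤φa
... | no x≢a rewrite removeElt-≢ A x≢a = hA′

-- The Demazure characterization, for φ(i) = k + 2 with k + 1 < n: the factors
-- B = r^(k+1) and A = r^(k+2) sit at position k and e_{k+1} acts on them.
module Characterization (w : ℕ → ℕ) (n : ℕ) (φ : ℕ → ℕ) (flag : IsFlag φ)
  (i : ℕ) (1≤i : 1 ≤ i) (i<φi : i < φ i) (minimal : ∀ m → 1 ≤ m → m < i → ¬ (m < φ m))
  (k : ℕ) (φi≡ : φ i ≡ suc (suc k)) (k+1<n : suc k < n) where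

  ψ : ℕ → ℕ
  ψ = φ -e i

  private
    φ-≥ : ∀ m → 1 ≤ m → m ≤ φ m
    φ-≥ = proj₁ flag
    φ-mono : ∀ a b → 1 ≤ a → a ≤ b → φ a ≤ φ b
    φ-mono = proj₂ flag

  i≤k+1 : i ≤ suc k
  i≤k+1 = ≤-pred (subst (i <_) φi≡ i<φi)

  φ-fixed-below-i : ∀ m → 1 ≤ m → m < i → φ m ≡ m
  φ-fixed-below-i m 1≤m m<i with m≤n⇒m<n∨m≡n (φ-≥ m 1≤m)
  ... | inj₁ m<φm = contradiction m<φm (minimal m 1≤m m<i)
  ... | inj₂ m≡φm = sym m≡φm

  level-k+1⇒≥i : ∀ b → 1 ≤ b → suc k ≤ φ b → i ≤ b
  level-k+1⇒≥i b 1≤b k+1≤φb with b <? i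
  ... | no b≮i = ≮⇒≥ b≮i
  ... | yes b<i = contradiction (subst (suc k ≤_) (φ-fixed-below-i b 1≤b b<i) k+1≤φb)
                                (<⇒≱ (<-≤-trans b<i i≤k+1))

  ≥i⇒level-k+2 : ∀ b → i ≤ b → suc (suc k) ≤ φ b
  ≥i⇒level-k+2 b i≤b = subst (_≤ φ b) φi≡ (φ-mono i b 1≤i i≤b)

  HeadBound-k+1⇒≥i : ∀ {L} → Sorted L → ValidWord L → HeadBound φ (suc k) L → All (i ≤_) L
  HeadBound-k+1⇒≥i {[]}    _ _           _ = []
  HeadBound-k+1⇒≥i {b ∷ _} s (1≤b ∷ _) h = All.map (≤-trans (level-k+1⇒≥i b 1≤b h)) (sorted-head-≤ s)

  ≥i⇒HeadBound : ∀ {l} L → l ≤ suc (suc k) → All (i ≤_) L → HeadBound φ l L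
  ≥i⇒HeadBound []      _ _           = tt
  ≥i⇒HeadBound (b ∷ _) l≤ (i≤b ∷ _) = ≤-trans l≤ (≥i⇒level-k+2 b i≤b)

  ψ-agrees : ∀ l x → l ≢ suc (suc k) → HeadBound φ l x → HeadBound ψ l x
  ψ-agrees l x l≢ = HeadBound-e φ i l x (λ l≡φi → l≢ (trans l≡φi φi≡))

  ψ-≤-φ : ∀ l x → 1 ≤ l → HeadBound ψ l x → HeadBound φ l x
  ψ-≤-φ l []      _ _    = tt
  ψ-≤-φ l (a ∷ _) _ l≤ψa = ≤-trans l≤ψa (-e-≤ φ i a)

  Reachable : Factorization n → Set
  Reachable c = ∃[ m ] ∃[ x ] (eIter (suc k) m c ≡ just x × RF n w x × FlaggedFrom ψ 1 x)

  flagged⇒B≥i : ∀ {c : Factorization n} {B A} → Adjacent k B A c → RF n w c → FlaggedFrom φ 1 c → All (i ≤_) B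
  flagged⇒B≥i p rf fl =
    HeadBound-k+1⇒≥i (proj₁ (RF-sorted p rf)) (proj₂ (RF-valid p rf)) (proj₁ (FlaggedFrom-adjacent 1 p fl))

  -- if A starts with i then i is unpaired, all letters of B being ≥ i
  raise-flagged : ∀ {c : Factorization n} {B A₀} (p : Adjacent k B (i ∷ A₀) c) → RF n w c → FlaggedFrom φ 1 c →
    ∃[ c′ ] ∃[ B′ ] ∃[ A′ ] (e (suc k) c ≡ just c′ × Adjacent k B′ A′ c′ ×
                             length A′ ≡ length A₀ × RF n w c′ × FlaggedFrom φ 1 c′)
  raise-flagged {c} {B} {A₀} p rf fl
    with u , us , U≡ ← ∈⇒nonempty (unpaired-keeps-≤ (i ∷ A₀) B (flagged⇒B≥i p rf fl) (here refl)) =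
    replace p B′ A′ , B′ , A′ , raiseAt-just p raisePair≡ , replace-adjacent p B′ A′ ,
    suc-injective (length-removeElt a∈A) , RF-raise p U≡ rf , fl′
    where
    A = i ∷ A₀
    open RaiseStep A B U≡
    B≥i : All (i ≤_) B
    B≥i = flagged⇒B≥i p rf fl
    fl′ : FlaggedFrom φ 1 (replace p B′ A′)
    fl′ = FlaggedFrom-replace 1 p fl
      (≥i⇒HeadBound B′ (n≤1+n _)
        (All-insertSorted⁺ B (≤-trans (unpaired-≤-a (unpaired-keeps-≤ A B B≥i (here refl))) (m≤m+n a s)) B≥i))
      (≥i⇒HeadBound A′ ≤-refl (anti-mono (removeElt-⊆ a A) (sorted-head-≤ (proj₂ (RF-sorted p rf)))))

  forward : ∀ fuel (c : Factorization n) {B A} (p : Adjacent k B A c) → length A ≤ fuel →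
    RF n w c → FlaggedFrom φ 1 c → Reachable c
  forward fuel c {A = []} p _ rf fl = 0 , c , refl , rf , FlaggedFrom-transfer 1 p ψ-agrees fl tt
  forward zero c {A = _ ∷ _} p () rf fl
  forward (suc fuel) c {A = a₀ ∷ A₀} p (s≤s length≤) rf fl with a₀ ≟ i
  ... | no a₀≢i = 0 , c , refl , rf , FlaggedFrom-transfer 1 p ψ-agrees fl
                    (subst (suc (suc k) ≤_) (sym (-e-≢ φ a₀≢i)) (proj₂ (FlaggedFrom-adjacent 1 p fl)))
  ... | yes refl =
    let (c′ , B′ , A′ , ec≡ , p′ , length≡ , rf′ , fl′) = raise-flagged p rf fl
        (m , x , eq , rfx , flx) = forward fuel c′ p′ (subst (_≤ fuel) (sym length≡) length≤) rf′ fl′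
    in suc m , x , trans (eIter-just {j = suc k} {m} ec≡) eq , rfx , flx

  -- B′ is flagged at level k+1 and contains a, so a and all letters of B are ≥ i
  backward : ∀ m (c : Factorization n) {B A} (p : Adjacent k B A c) → RF n w c →
    ∀ {x} → eIter (suc k) m c ≡ just x → FlaggedFrom ψ 1 x → FlaggedFrom φ 1 c
  backward zero    c p rf refl flx = FlaggedFrom-mono 1 c ψ-≤-φ flx
  backward (suc m) c {B} {A} p rf eq flx with empty-or-cons (unpaired A B)
  ... | inj₁ U≡ = contradiction
    (trans (sym (eIter-nothing {j = suc k} {m} (raiseAt-nothing p (raisePair-nothing {B} {A} U≡)))) eq) λ ()
  ... | inj₂ (_ , _ , U≡) =
    FlaggedFrom-replace⁻ 1 p fl′ (≥i⇒HeadBound B (n≤1+n _) B≥i)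
      (HeadBound-removeElt A (proj₂ (FlaggedFrom-adjacent 1 p′ fl′)) (≥i⇒level-k+2 a i≤a))
    where
    open RaiseStep A B U≡
    p′ : Adjacent k B′ A′ (replace p B′ A′)
    p′ = replace-adjacent p B′ A′
    rf′ : RF n w (replace p B′ A′)
    rf′ = RF-raise p U≡ rf
    fl′ : FlaggedFrom φ 1 (replace p B′ A′)
    fl′ = backward m (replace p B′ A′) p′ rf′
            (trans (sym (eIter-just {j = suc k} {m} (raiseAt-just p raisePair≡))) eq) flx
    B′≥i : All (i ≤_) B′
    B′≥i = flagged⇒B≥i p′ rf′ fl′
    B≥i : All (i ≤_) B
    B≥i = proj₂ (All-insertSorted⁻ B B′≥i)
    i≤a : i ≤ a
    i≤a = All.lookup B′≥i (a∈B′ (proj₂ (RF-sorted p rf)) (proj₁ (RF-sorted p rf)))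

  RFC⇔Demazure : ∀ b → RFC n w φ b ⇔ Demazure n w (suc k) (RFC n w ψ) b
  RFC⇔Demazure b with B , A , p ← adjacent b k k+1<n = mk⇔ to from
    where
    to : RFC n w φ b → Demazure n w (suc k) (RFC n w ψ) b
    to (rf , fl) =
      let (m , x , eq , rfx , flx) = forward (length A) b p ≤-refl rf (FlaggedFrom⁺ 1 b fl)
      in rf , m , x , eq , rfx , FlaggedFrom⁻ 1 x flx
    from : Demazure n w (suc k) (RFC n w ψ) b → RFC n w φ b
    from (rf , m , x , eq , rfx , flx) = rf , FlaggedFrom⁻ 1 b (backward m b p rf eq (FlaggedFrom⁺ 1 x flx))

≥2⇒suc-suc : ∀ {m} → 2 ≤ m → ∃[ k ] m ≡ suc (suc k)
≥2⇒suc-suc {suc (suc k)} _ = k , refl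
≥2⇒suc-suc {suc zero} (s≤s ())

theorem4p5 : (w : ℕ → ℕ) → InSInf w → (n : ℕ) → 1 ≤ n →
    (φ : ℕ → ℕ) → IsFlag φ → ¬ IsIdentityFlag φ →
    (i : ℕ) → 1 ≤ i → i < φ i → (∀ m → 1 ≤ m → m < i → ¬ (m < φ m)) →
    ((n < i ⊎ n ≤ φ i ∸ 1) →
       ∀ b → RFC n w φ b ⇔ RFC n w (φ -e i) b)
    × ((i ≤ n × φ i ∸ 1 < n) →
       ∀ b → RFC n w φ b ⇔ Demazure n w (φ i ∸ 1) (RFC n w (φ -e i)) b)
theorem4p5 w _ n _ φ flag _ i 1≤i i<φi minimal = part₁ , part₂
  where
  part₁ : (n < i ⊎ n ≤ φ i ∸ 1) → ∀ b → RFC n w φ b ⇔ RFC n w (φ -e i) b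
  part₁ n-small b = mk⇔ (map₂ (Equivalence.to flagged⇔)) (map₂ (Equivalence.from flagged⇔))
    where
    flagged⇔ : Flagged φ b ⇔ Flagged (φ -e i) b
    flagged⇔ = Flagged-e φ i b ([ (λ n<i → ≤-trans (<⇒≤ n<i) (<⇒≤∸1 i<φi)) , id ]′ n-small)
  part₂ : (i ≤ n × φ i ∸ 1 < n) → ∀ b → RFC n w φ b ⇔ Demazure n w (φ i ∸ 1) (RFC n w (φ -e i)) b
  part₂ (_ , j<n) with k , φi≡ ← ≥2⇒suc-suc (<-≤-trans (s≤s 1≤i) i<φi) =
    subst (λ j → ∀ b → RFC n w φ b ⇔ Demazure n w j (RFC n w (φ -e i)) b) (cong (_∸ 1) (sym φi≡))
      (Characterization.RFC⇔Demazure w n φ flag i 1≤i i<φi minimal k φi≡ (subst (_< n) (cong (_∸ 1) φi≡) j<n))
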